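{- Let $G$ be a $C_5$-free graph, let $S$ be a maximum strong clique of $G$, and let $H$ be the subgraph of $G$ induced by the edge set $S$. If $H$ is $C_3$-free and $G$ is $E(H)$-minimal, then $G$ is bipartite.
   Context: All graphs are finite and simple. $C_n$ is the cycle on $n$ vertices; $F$-free means containing no subgraph isomorphic to $F$. The distance between two edges of $G$ is the distance between the corresponding vertices in the line graph of $G$. A strong clique of $G$ is a set of edges with pairwise distance at most $2$; a maximum strong clique is one of largest size. The subgraph induced by an edge set consists of these edges and their endpoints. For a strong clique $S$ of $G$, $G$ is $S$-minimal if $S$ is not a strong clique of any proper subgraph of $G$. -}

module Defs where

open import Data.Nat using (ℕ; zero; suc; _≤_) renaming (_<ᵇ_ to _<ᵇ_)
open import Data.Fin using (Fin; zero; suc; toℕ; inject₁; fromℕ)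
open import Data.Bool using (Bool; true; false; _∧_; if_then_else_)
open import Data.List using (List; map; allFin)
open import Data.Nat.ListAction using (sum)
open import Data.Product using (Σ; ∃; _×_; _,_; proj₁; proj₂)
open import Data.Sum using (_⊎_)
open import Data.Empty using (⊥)
open import Relation.Nullary using (¬_)
open import Relation.Binary.PropositionalEquality using (_≡_; _≢_)

-- Finite simple graphs whose vertex set is a subset V of Fin n.
-- (Every finite graph is isomorphic to one of these; the ambient Fin n
-- lets subgraphs live on the same vertex type.)

record Graph (n : ℕ) : Set₁ where
  field
    V     : Fin n → Set
    E     : Fin n → Fin n → Set
    E-sym : ∀ {u v} → E u v → E v u
    E-irr : ∀ {u} → ¬ E u u
    E-V   : ∀ {u v} → E u v → V u
open Graph public

HasCycle : ∀ {n} → ℕ → (Fin n → Set) → (Fin n → Fin n → Set) → Set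
HasCycle zero    V E = ⊥
HasCycle {n} (suc m) V E =
  Σ (Fin (suc m) → Fin n) λ f →
    (∀ i j → f i ≡ f j → i ≡ j)
    × (∀ i → V (f i))
    × (∀ (i : Fin m) → E (f (inject₁ i)) (f (suc i)))
    × E (f (fromℕ m)) (f zero)

CFree : ∀ {n} → ℕ → Graph n → Set
CFree k G = ¬ HasCycle k (V G) (E G)

Bipartite : ∀ {n} → Graph n → Set
Bipartite {n} G = Σ (Fin n → Bool) λ c → ∀ u v → E G u v → c u ≢ c v

-- Edge sets (finite, hence decidable) as Boolean symmetric matrices;
-- the edge {u,v} belongs to S iff S u v ≡ true.

EdgeSet : ℕ → Set
EdgeSet n = Fin n → Fin n → Bool

-- A pair of vertices, representing the (unordered) edge {u,v}
Pair : ℕ → Set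
Pair n = Fin n × Fin n

_∈ₛ_ : ∀ {n} → Pair n → EdgeSet n → Set
(u , v) ∈ₛ S = S u v ≡ true

SameEdge : ∀ {n} → Pair n → Pair n → Set
SameEdge (u , v) (x , y) = (u ≡ x × v ≡ y) ⊎ (u ≡ y × v ≡ x)

Touch : ∀ {n} → Pair n → Pair n → Set
Touch (u , v) (x , y) = (u ≡ x ⊎ u ≡ y) ⊎ (v ≡ x ⊎ v ≡ y)

LineAdj : ∀ {n} → Pair n → Pair n → Set
LineAdj e f = ¬ SameEdge e f × Touch e f

IsEdge : ∀ {n} → Graph n → Pair n → Set
IsEdge G (u , v) = E G u v

Dist≤2 : ∀ {n} → Graph n → Pair n → Pair n → Set
Dist≤2 {n} G e f =
  SameEdge e f
  ⊎ LineAdj e f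
  ⊎ Σ (Pair n) (λ g → IsEdge G g × LineAdj e g × LineAdj g f)

StrongClique : ∀ {n} → Graph n → EdgeSet n → Set
StrongClique G S =
  (∀ u v → S u v ≡ S v u)
  × (∀ e → e ∈ₛ S → IsEdge G e)
  × (∀ e f → e ∈ₛ S → f ∈ₛ S → Dist≤2 G e f)

-- number of edges of S (each unordered edge {u,v} counted once, u < v)
edgeCount : ∀ {n} → EdgeSet n → ℕ
edgeCount {n} S =
  sum (map (λ u → sum (map (λ v →
        if (toℕ u <ᵇ toℕ v) ∧ S u v then 1 else 0) (allFin n))) (allFin n))

MaximumStrongClique : ∀ {n} → Graph n → EdgeSet n → Set
MaximumStrongClique {n} G S =
  StrongClique G S × (∀ (S′ : EdgeSet n) → StrongClique G S′ → edgeCount S′ ≤ edgeCount S)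

Subgraph : ∀ {n} → Graph n → Graph n → Set
Subgraph G′ G = (∀ v → V G′ v → V G v) × (∀ u v → E G′ u v → E G u v)

ProperSubgraph : ∀ {n} → Graph n → Graph n → Set
ProperSubgraph G′ G =
  Subgraph G′ G × ¬ ((∀ v → V G v → V G′ v) × (∀ u v → E G u v → E G′ u v))

Minimal : ∀ {n} → Graph n → EdgeSet n → Set₁
Minimal {n} G S = ∀ (G′ : Graph n) → ProperSubgraph G′ G → ¬ StrongClique G′ S

InducedV : ∀ {n} → EdgeSet n → Fin n → Set
InducedV {n} S v = Σ (Fin n) λ w → S v w ≡ true

InducedE : ∀ {n} → EdgeSet n → Fin n → Fin n → Set
InducedE S u v = S u v ≡ true

-- Two edges are at distance at most 2 iff an endpoint of one equals or is adjacent to an endpoint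
-- of the other. Let xy be an edge of G outside S. Minimality makes xy the only link between two
-- S-edges xa and yb, and maximality gives an S-edge pq at distance more than 2 from xy. If xyz
-- were a triangle, a and b would attach to p or q, and every way of doing so closes a C₅ (for
-- crossed attachments after the same reasoning for xz and yz forces z ~ a and z ~ b). So every
-- triangle lies in S, which is excluded, and G is triangle-free. Every non-isolated vertex lies
-- on an S-edge, hence within distance 2 of a fixed S-edge uv; colouring by the parity of the
-- distance from u (with all vertices at distance ≥ 3 in one class) is then proper, since a
-- monochromatic edge would close a C₃ or a C₅.

module Submission where

open import Defs
open import Axiom.UniquenessOfIdentityProofs using (module Decidable⇒UIP)
open import Data.Bool using (Bool; true; false; _∧_; if_then_else_)
open import Data.Bool.Properties using () renaming (_≟_ to _≟ᵇ_)
open import Data.Empty using (⊥; ⊥-elim)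
open import Data.Fin using (Fin; zero; suc; toℕ; inject₁; _≟_)
open import Data.Fin.Properties using (any?; toℕ-injective)
open import Data.List using (List; []; _∷_; map; allFin)
open import Data.List.Membership.Propositional using (_∈_)
open import Data.List.Membership.Propositional.Properties using (∈-allFin)
open import Data.List.Relation.Unary.Any using (here; there)
open import Data.Maybe using (Maybe; just; nothing)
import Data.Maybe.Properties as Maybe
open import Data.Nat using (ℕ; _≤_; _<_; _<ᵇ_; z≤n)
open import Data.Nat.ListAction using (sum)
open import Data.Nat.Properties using (+-mono-≤; +-mono-<-≤; +-mono-≤-<; ≤-refl; <⇒<ᵇ; <⇒≱; <-cmp)
open import Data.Product using (Σ; _×_; _,_; proj₁; proj₂)
import Data.Product.Properties as Product
open import Data.Sum using (_⊎_; inj₁; inj₂; [_,_]′)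
open import Function using (_∘_)
open import Relation.Binary.Definitions using (Decidable; tri<; tri≈; tri>)
open import Relation.Binary.PropositionalEquality using (_≡_; _≢_; refl; sym; trans; cong₂)
open import Relation.Nullary using (¬_; Dec; yes; no; ¬?)
open import Relation.Nullary.Decidable using (map′; _×-dec_; _⊎-dec_)

anyPair? : ∀ {n} {P : Pair n → Set} → (∀ e → Dec (P e)) → Dec (Σ (Pair n) P)
anyPair? P? = map′ (λ (u , v , p) → (u , v) , p) (λ ((u , v) , p) → u , v , p)
                   (any? λ u → any? λ v → P? (u , v))

sum-map-mono-≤ : ∀ {A : Set} (xs : List A) {f g : A → ℕ} →
                 (∀ x → f x ≤ g x) → sum (map f xs) ≤ sum (map g xs)
sum-map-mono-≤ []       f≤g = z≤n
sum-map-mono-≤ (x ∷ xs) f≤g = +-mono-≤ (f≤g x) (sum-map-mono-≤ xs f≤g)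

sum-map-mono-< : ∀ {A : Set} {xs : List A} {f g : A → ℕ} → (∀ x → f x ≤ g x) →
                 ∀ {x} → x ∈ xs → f x < g x → sum (map f xs) < sum (map g xs)
sum-map-mono-< {xs = x ∷ xs} f≤g (here refl) fx<gx = +-mono-<-≤ fx<gx (sum-map-mono-≤ xs f≤g)
sum-map-mono-< {xs = x ∷ xs} f≤g (there y∈xs) fy<gy = +-mono-≤-< (f≤g x) (sum-map-mono-< f≤g y∈xs fy<gy)

module _ {n : ℕ} where

  _∈ₛ?_ : (e : Pair n) (S : EdgeSet n) → Dec (e ∈ₛ S)
  (u , v) ∈ₛ? S = S u v ≟ᵇ true

  _⊆ₛ_ : EdgeSet n → EdgeSet n → Set
  S ⊆ₛ S′ = ∀ u v → S u v ≡ true → S′ u v ≡ true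

  SymmetricEdgeSet : EdgeSet n → Set
  SymmetricEdgeSet S = ∀ u v → S u v ≡ S v u

  sameEdge? : Decidable (SameEdge {n})
  sameEdge? (u₁ , u₂) (w₁ , w₂) = ((u₁ ≟ w₁) ×-dec (u₂ ≟ w₂)) ⊎-dec ((u₁ ≟ w₂) ×-dec (u₂ ≟ w₁))

  sameEdge-swapˡ : ∀ {u v : Fin n} {e} → SameEdge (u , v) e → SameEdge (v , u) e
  sameEdge-swapˡ (inj₁ (p , q)) = inj₂ (q , p)
  sameEdge-swapˡ (inj₂ (p , q)) = inj₁ (q , p)

  Endpoint : Fin n → Pair n → Set
  Endpoint c e = c ≡ proj₁ e ⊎ c ≡ proj₂ e

  sameEdge-sym : ∀ {e f : Pair n} → SameEdge e f → SameEdge f e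
  sameEdge-sym (inj₁ (p , q)) = inj₁ (sym p , sym q)
  sameEdge-sym (inj₂ (p , q)) = inj₂ (sym q , sym p)

  sameEdge⇒endpoint₁ : ∀ {g e : Pair n} → SameEdge g e → Endpoint (proj₁ g) e
  sameEdge⇒endpoint₁ (inj₁ (p , _)) = inj₁ p
  sameEdge⇒endpoint₁ (inj₂ (p , _)) = inj₂ p

  sameEdge⇒endpoint₂ : ∀ {g e : Pair n} → SameEdge g e → Endpoint (proj₂ g) e
  sameEdge⇒endpoint₂ (inj₁ (_ , q)) = inj₂ q
  sameEdge⇒endpoint₂ (inj₂ (_ , q)) = inj₁ q

  touch⇒shared : ∀ {e f} → Touch e f → Σ (Fin n) λ c → Endpoint c e × Endpoint c f
  touch⇒shared {u , _} (inj₁ u∈f) = u , inj₁ refl , u∈f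
  touch⇒shared {_ , v} (inj₂ v∈f) = v , inj₂ refl , v∈f

  shared⇒touch : ∀ {c e f} → Endpoint c e → Endpoint c f → Touch e f
  shared⇒touch (inj₁ refl) c∈f = inj₁ c∈f
  shared⇒touch (inj₂ refl) c∈f = inj₂ c∈f

  sameEdge⇒touch : ∀ {e f : Pair n} → SameEdge e f → Touch e f
  sameEdge⇒touch (inj₁ (u≡x , _)) = inj₁ (inj₁ u≡x)
  sameEdge⇒touch (inj₂ (u≡y , _)) = inj₁ (inj₂ u≡y)

  touch? : Decidable (Touch {n})
  touch? (u₁ , u₂) (w₁ , w₂) = ((u₁ ≟ w₁) ⊎-dec (u₁ ≟ w₂)) ⊎-dec ((u₂ ≟ w₁) ⊎-dec (u₂ ≟ w₂))

  addEdge : EdgeSet n → Fin n → Fin n → EdgeSet n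
  addEdge S x y u v with sameEdge? (u , v) (x , y)
  ... | yes _ = true
  ... | no  _ = S u v

  module _ {S : EdgeSet n} {x y : Fin n} where

    addEdge-⊇ : S ⊆ₛ addEdge S x y
    addEdge-⊇ u v Suv with sameEdge? (u , v) (x , y)
    ... | yes _ = refl
    ... | no  _ = Suv

    addEdge-new : addEdge S x y x y ≡ true
    addEdge-new with sameEdge? (x , y) (x , y)
    ... | yes _     = refl
    ... | no ¬same = ⊥-elim (¬same (inj₁ (refl , refl)))

    addEdge-elim : ∀ {u v} → addEdge S x y u v ≡ true → S u v ≡ true ⊎ SameEdge (u , v) (x , y)
    addEdge-elim {u} {v} with sameEdge? (u , v) (x , y)
    ... | yes same = λ _ → inj₂ same
    ... | no  _    = inj₁

    addEdge-sym : SymmetricEdgeSet S → SymmetricEdgeSet (addEdge S x y)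
    addEdge-sym S-sym u v with sameEdge? (u , v) (x , y) | sameEdge? (v , u) (x , y)
    ... | yes _    | yes _    = refl
    ... | no  _    | no  _    = S-sym u v
    ... | yes same | no ¬same = ⊥-elim (¬same (sameEdge-swapˡ same))
    ... | no ¬same | yes same = ⊥-elim (¬same (sameEdge-swapˡ same))

  edgeCount-<-ordered : ∀ {S S′ : EdgeSet n} {i j} → S ⊆ₛ S′ → toℕ i < toℕ j →
                        S i j ≡ false → S′ i j ≡ true → edgeCount S < edgeCount S′
  edgeCount-<-ordered {S} {S′} {i} {j} S⊆S′ i<j Sij S′ij =
    sum-map-mono-< (λ u → sum-map-mono-≤ (allFin n) (indicator-mono u)) (∈-allFin i)
      (sum-map-mono-< (indicator-mono i) (∈-allFin j) new)
    where
    indicator-mono : ∀ u v → (if (toℕ u <ᵇ toℕ v) ∧ S u v then 1 else 0)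
                             ≤ (if (toℕ u <ᵇ toℕ v) ∧ S′ u v then 1 else 0)
    indicator-mono u v with toℕ u <ᵇ toℕ v | S u v in Suv
    ... | false | _    = z≤n
    ... | true  | false = z≤n
    ... | true  | true rewrite S⊆S′ u v Suv = ≤-refl
    new : (if (toℕ i <ᵇ toℕ j) ∧ S i j then 1 else 0) < (if (toℕ i <ᵇ toℕ j) ∧ S′ i j then 1 else 0)
    new with toℕ i <ᵇ toℕ j | <⇒<ᵇ i<j
    ... | true | _ rewrite Sij | S′ij = ≤-refl

  edgeCount-< : ∀ {S S′ : EdgeSet n} {i j} → SymmetricEdgeSet S → SymmetricEdgeSet S′ →
                S ⊆ₛ S′ → i ≢ j → S i j ≡ false → S′ i j ≡ true → edgeCount S < edgeCount S′
  edgeCount-< {i = i} {j} S-sym S′-sym S⊆S′ i≢j Sij S′ij with <-cmp (toℕ i) (toℕ j)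
  ... | tri< i<j _ _ = edgeCount-<-ordered S⊆S′ i<j Sij S′ij
  ... | tri≈ _ i≡j _ = ⊥-elim (i≢j (toℕ-injective i≡j))
  ... | tri> _ _ j<i = edgeCount-<-ordered S⊆S′ j<i (trans (S-sym j i) Sij) (trans (S′-sym j i) S′ij)

module _ {n : ℕ} (G : Graph n) where

  Close : Fin n → Fin n → Set
  Close u w = u ≡ w ⊎ E G u w

  EdgesClose : Pair n → Pair n → Set
  EdgesClose (u₁ , u₂) (w₁ , w₂) = (Close u₁ w₁ ⊎ Close u₁ w₂) ⊎ (Close u₂ w₁ ⊎ Close u₂ w₂)

  TwoStep : Fin n → Fin n → Set
  TwoStep u w = Σ (Fin n) λ r → E G u r × E G r w

  Within2 : Fin n → Fin n → Set
  Within2 u w = Σ (Fin n) λ r → Close u r × Close r w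

  TriangleFree : Set
  TriangleFree = ∀ {x y z} → E G x y → E G y z → E G z x → ⊥

  edge⇒≢ : ∀ {u v} → E G u v → u ≢ v
  edge⇒≢ uv refl = E-irr G uv

  close-sym : ∀ {u w} → Close u w → Close w u
  close-sym (inj₁ u≡w) = inj₁ (sym u≡w)
  close-sym (inj₂ uw)  = inj₂ (E-sym G uw)

  edgesClose-sym : ∀ {e f} → EdgesClose e f → EdgesClose f e
  edgesClose-sym (inj₁ (inj₁ c)) = inj₁ (inj₁ (close-sym c))
  edgesClose-sym (inj₁ (inj₂ c)) = inj₂ (inj₁ (close-sym c))
  edgesClose-sym (inj₂ (inj₁ c)) = inj₁ (inj₂ (close-sym c))
  edgesClose-sym (inj₂ (inj₂ c)) = inj₂ (inj₂ (close-sym c))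

  edgesClose-swapˡ : ∀ {u v f} → EdgesClose (u , v) f → EdgesClose (v , u) f
  edgesClose-swapˡ (inj₁ c) = inj₂ c
  edgesClose-swapˡ (inj₂ c) = inj₁ c

  edgesClose-swapʳ : ∀ {e u v} → EdgesClose e (u , v) → EdgesClose e (v , u)
  edgesClose-swapʳ = edgesClose-sym ∘ edgesClose-swapˡ ∘ edgesClose-sym

  edgesClose-respˡ : ∀ {u v x y f} → SameEdge (u , v) (x , y) → EdgesClose (x , y) f → EdgesClose (u , v) f
  edgesClose-respˡ (inj₁ (refl , refl)) c = c
  edgesClose-respˡ (inj₂ (refl , refl)) c = edgesClose-swapˡ c

  edgesClose-refl : ∀ {e} → EdgesClose e e
  edgesClose-refl = inj₁ (inj₁ (inj₁ refl))

  endpoints-close : ∀ {g c d} → IsEdge G g → Endpoint c g → Endpoint d g → Close c d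
  endpoints-close g-edge (inj₁ refl) (inj₁ refl) = inj₁ refl
  endpoints-close g-edge (inj₁ refl) (inj₂ refl) = inj₂ g-edge
  endpoints-close g-edge (inj₂ refl) (inj₁ refl) = inj₂ (E-sym G g-edge)
  endpoints-close g-edge (inj₂ refl) (inj₂ refl) = inj₁ refl

  close⇒edgesClose : ∀ {a b e f} → Endpoint a e → Endpoint b f → Close a b → EdgesClose e f
  close⇒edgesClose (inj₁ refl) (inj₁ refl) c = inj₁ (inj₁ c)
  close⇒edgesClose (inj₁ refl) (inj₂ refl) c = inj₁ (inj₂ c)
  close⇒edgesClose (inj₂ refl) (inj₁ refl) c = inj₂ (inj₁ c)
  close⇒edgesClose (inj₂ refl) (inj₂ refl) c = inj₂ (inj₂ c)

  touch⇒edgesClose : ∀ {e f} → Touch e f → EdgesClose e f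
  touch⇒edgesClose t with touch⇒shared t
  ... | _ , c∈e , c∈f = close⇒edgesClose c∈e c∈f (inj₁ refl)

  dist≤2⇒edgesClose : ∀ {e f} → Dist≤2 G e f → EdgesClose e f
  dist≤2⇒edgesClose (inj₁ same)         = touch⇒edgesClose (sameEdge⇒touch same)
  dist≤2⇒edgesClose (inj₂ (inj₁ (_ , t))) = touch⇒edgesClose t
  dist≤2⇒edgesClose (inj₂ (inj₂ (_ , g-edge , (_ , eg) , (_ , gf))))
    with touch⇒shared eg | touch⇒shared gf
  ... | _ , c∈e , c∈g | _ , d∈g , d∈f = close⇒edgesClose c∈e d∈f (endpoints-close g-edge c∈g d∈g)

  touch⇒dist≤2 : ∀ {e f} → Touch e f → Dist≤2 G e f
  touch⇒dist≤2 {e} {f} t with sameEdge? e f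
  ... | yes same = inj₁ same
  ... | no ¬same = inj₂ (inj₁ (¬same , t))

  viaEdge : ∀ {a b e f} → ¬ Touch e f → E G a b → Endpoint a e → Endpoint b f → Dist≤2 G e f
  viaEdge ¬t ab a∈e b∈f =
    inj₂ (inj₂ (_ , ab , (¬same₁ , shared⇒touch a∈e (inj₁ refl)) , (¬same₂ , shared⇒touch (inj₂ refl) b∈f)))
    where
    ¬same₁ = λ same → ¬t (shared⇒touch (sameEdge⇒endpoint₂ (sameEdge-sym same)) b∈f)
    ¬same₂ = λ same → ¬t (shared⇒touch a∈e (sameEdge⇒endpoint₁ same))

  close⇒dist≤2 : ∀ {a b e f} → Endpoint a e → Endpoint b f → Close a b → Dist≤2 G e f
  close⇒dist≤2 a∈e b∈f (inj₁ refl) = touch⇒dist≤2 (shared⇒touch a∈e b∈f)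
  close⇒dist≤2 {e = e} {f} a∈e b∈f (inj₂ ab) with touch? e f
  ... | yes t  = touch⇒dist≤2 t
  ... | no ¬t = viaEdge ¬t ab a∈e b∈f

  edgesClose⇒dist≤2 : ∀ {e f} → EdgesClose e f → Dist≤2 G e f
  edgesClose⇒dist≤2 (inj₁ (inj₁ c)) = close⇒dist≤2 (inj₁ refl) (inj₁ refl) c
  edgesClose⇒dist≤2 (inj₁ (inj₂ c)) = close⇒dist≤2 (inj₁ refl) (inj₂ refl) c
  edgesClose⇒dist≤2 (inj₂ (inj₁ c)) = close⇒dist≤2 (inj₂ refl) (inj₁ refl) c
  edgesClose⇒dist≤2 (inj₂ (inj₂ c)) = close⇒dist≤2 (inj₂ refl) (inj₂ refl) c

  module _ (E? : Decidable (E G)) where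

    close? : Decidable Close
    close? u w = (u ≟ w) ⊎-dec E? u w

    edgesClose? : Decidable EdgesClose
    edgesClose? (u₁ , u₂) (w₁ , w₂) =
      (close? u₁ w₁ ⊎-dec close? u₁ w₂) ⊎-dec (close? u₂ w₁ ⊎-dec close? u₂ w₂)

    twoStep? : Decidable TwoStep
    twoStep? u w = any? λ r → E? u r ×-dec E? r w

restrict : ∀ {n} (G : Graph n) (P : Fin n → Fin n → Set) → (∀ {u v} → P u v → P v u) → Graph n
restrict G P P-sym = record
  { V     = V G
  ; E     = λ u v → E G u v × P u v
  ; E-sym = λ (uv , p) → E-sym G uv , P-sym p
  ; E-irr = λ (uu , _) → E-irr G uu
  ; E-V   = λ (uv , _) → E-V G uv
  }

restrict-proper : ∀ {n} {G : Graph n} {P : Fin n → Fin n → Set} {P-sym : ∀ {u v} → P u v → P v u} {x y} →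
                   E G x y → ¬ P x y → ProperSubgraph (restrict G P P-sym) G
restrict-proper {x = x} {y} xy ¬Pxy =
  ((λ _ v → v) , (λ _ _ → proj₁)) , λ (_ , E⊆) → ¬Pxy (proj₂ (E⊆ x y xy))

_∖_ : ∀ {n} → Graph n → Pair n → Graph n
G ∖ e = restrict G (λ u v → ¬ SameEdge (u , v) e) (λ ¬same → ¬same ∘ sameEdge-swapˡ)

∖-proper : ∀ {n} (G : Graph n) {x y} → E G x y → ProperSubgraph (G ∖ (x , y)) G
∖-proper G xy =
  restrict-proper {G = G} {P-sym = λ ¬same → ¬same ∘ sameEdge-swapˡ} xy (λ ¬same → ¬same (inj₁ (refl , refl)))

module _ {n : ℕ} {V : Fin n → Set} {E : Fin n → Fin n → Set}
         (E-V : ∀ {u v} → E u v → V u) (E-irr : ∀ {u} → ¬ E u u) where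

  private
    ≢-edge : ∀ {u v} → E u v → u ≢ v
    ≢-edge uv refl = E-irr uv

  triangle : ∀ {x y z} → E x y → E y z → E z x → HasCycle 3 V E
  triangle {x} {y} {z} xy yz zx = f , injective , (λ i → E-V (proj₂ (edge-from i))) , path , zx
    where
    f : Fin 3 → Fin n
    f zero             = x
    f (suc zero)       = y
    f (suc (suc zero)) = z
    edge-from : ∀ i → Σ (Fin n) (E (f i))
    edge-from zero             = y , xy
    edge-from (suc zero)       = z , yz
    edge-from (suc (suc zero)) = x , zx
    path : ∀ (i : Fin 2) → E (f (inject₁ i)) (f (suc i))
    path zero       = xy
    path (suc zero) = yz
    injective : ∀ i j → f i ≡ f j → i ≡ j
    injective zero             zero             _  = refl
    injective zero             (suc zero)       eq = ⊥-elim (≢-edge xy eq)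
    injective zero             (suc (suc zero)) eq = ⊥-elim (≢-edge zx (sym eq))
    injective (suc zero)       zero             eq = ⊥-elim (≢-edge xy (sym eq))
    injective (suc zero)       (suc zero)       _  = refl
    injective (suc zero)       (suc (suc zero)) eq = ⊥-elim (≢-edge yz eq)
    injective (suc (suc zero)) zero             eq = ⊥-elim (≢-edge zx eq)
    injective (suc (suc zero)) (suc zero)       eq = ⊥-elim (≢-edge yz (sym eq))
    injective (suc (suc zero)) (suc (suc zero)) _  = refl

  pentagon : ∀ {v₀ v₁ v₂ v₃ v₄} → v₀ ≢ v₂ → v₀ ≢ v₃ → v₁ ≢ v₃ → v₁ ≢ v₄ → v₂ ≢ v₄ →
             E v₀ v₁ → E v₁ v₂ → E v₂ v₃ → E v₃ v₄ → E v₄ v₀ → HasCycle 5 V E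
  pentagon {v₀} {v₁} {v₂} {v₃} {v₄} v₀≢v₂ v₀≢v₃ v₁≢v₃ v₁≢v₄ v₂≢v₄ e₀₁ e₁₂ e₂₃ e₃₄ e₄₀ =
    f , injective , (λ i → E-V (proj₂ (edge-from i))) , path , e₄₀
    where
    f : Fin 5 → Fin n
    f zero                         = v₀
    f (suc zero)                   = v₁
    f (suc (suc zero))             = v₂
    f (suc (suc (suc zero)))       = v₃
    f (suc (suc (suc (suc zero)))) = v₄
    edge-from : ∀ i → Σ (Fin n) (E (f i))
    edge-from zero                         = v₁ , e₀₁
    edge-from (suc zero)                   = v₂ , e₁₂
    edge-from (suc (suc zero))             = v₃ , e₂₃
    edge-from (suc (suc (suc zero)))       = v₄ , e₃₄
    edge-from (suc (suc (suc (suc zero)))) = v₀ , e₄₀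
    path : ∀ (i : Fin 4) → E (f (inject₁ i)) (f (suc i))
    path zero                   = e₀₁
    path (suc zero)             = e₁₂
    path (suc (suc zero))       = e₂₃
    path (suc (suc (suc zero))) = e₃₄
    v₀≢v₁ = ≢-edge e₀₁ ; v₁≢v₂ = ≢-edge e₁₂ ; v₂≢v₃ = ≢-edge e₂₃ ; v₃≢v₄ = ≢-edge e₃₄
    v₀≢v₄ = λ eq → ≢-edge e₄₀ (sym eq)
    injective : ∀ i j → f i ≡ f j → i ≡ j
    injective zero zero _ = refl
    injective zero (suc zero) eq = ⊥-elim (v₀≢v₁ eq)
    injective zero (suc (suc zero)) eq = ⊥-elim (v₀≢v₂ eq)
    injective zero (suc (suc (suc zero))) eq = ⊥-elim (v₀≢v₃ eq)
    injective zero (suc (suc (suc (suc zero)))) eq = ⊥-elim (v₀≢v₄ eq)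
    injective (suc zero) zero eq = ⊥-elim (v₀≢v₁ (sym eq))
    injective (suc zero) (suc zero) _ = refl
    injective (suc zero) (suc (suc zero)) eq = ⊥-elim (v₁≢v₂ eq)
    injective (suc zero) (suc (suc (suc zero))) eq = ⊥-elim (v₁≢v₃ eq)
    injective (suc zero) (suc (suc (suc (suc zero)))) eq = ⊥-elim (v₁≢v₄ eq)
    injective (suc (suc zero)) zero eq = ⊥-elim (v₀≢v₂ (sym eq))
    injective (suc (suc zero)) (suc zero) eq = ⊥-elim (v₁≢v₂ (sym eq))
    injective (suc (suc zero)) (suc (suc zero)) _ = refl
    injective (suc (suc zero)) (suc (suc (suc zero))) eq = ⊥-elim (v₂≢v₃ eq)
    injective (suc (suc zero)) (suc (suc (suc (suc zero)))) eq = ⊥-elim (v₂≢v₄ eq)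
    injective (suc (suc (suc zero))) zero eq = ⊥-elim (v₀≢v₃ (sym eq))
    injective (suc (suc (suc zero))) (suc zero) eq = ⊥-elim (v₁≢v₃ (sym eq))
    injective (suc (suc (suc zero))) (suc (suc zero)) eq = ⊥-elim (v₂≢v₃ (sym eq))
    injective (suc (suc (suc zero))) (suc (suc (suc zero))) _ = refl
    injective (suc (suc (suc zero))) (suc (suc (suc (suc zero)))) eq = ⊥-elim (v₃≢v₄ eq)
    injective (suc (suc (suc (suc zero)))) zero eq = ⊥-elim (v₀≢v₄ (sym eq))
    injective (suc (suc (suc (suc zero)))) (suc zero) eq = ⊥-elim (v₁≢v₄ (sym eq))
    injective (suc (suc (suc (suc zero)))) (suc (suc zero)) eq = ⊥-elim (v₂≢v₄ (sym eq))
    injective (suc (suc (suc (suc zero)))) (suc (suc (suc zero))) eq = ⊥-elim (v₃≢v₄ (sym eq))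
    injective (suc (suc (suc (suc zero)))) (suc (suc (suc (suc zero)))) _ = refl

noPentagon : ∀ {n} (G : Graph n) → CFree 5 G → ∀ {v₀ v₁ v₂ v₃ v₄} →
             v₀ ≢ v₂ → v₀ ≢ v₃ → v₁ ≢ v₃ → v₁ ≢ v₄ → v₂ ≢ v₄ →
             E G v₀ v₁ → E G v₁ v₂ → E G v₂ v₃ → E G v₃ v₄ → E G v₄ v₀ → ⊥
noPentagon G noC5 v₀≢v₂ v₀≢v₃ v₁≢v₃ v₁≢v₄ v₂≢v₄ e₀₁ e₁₂ e₂₃ e₃₄ e₄₀ =
  noC5 (pentagon (E-V G) (E-irr G) v₀≢v₂ v₀≢v₃ v₁≢v₃ v₁≢v₄ v₂≢v₄ e₀₁ e₁₂ e₂₃ e₃₄ e₄₀)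

module _ {n : ℕ} (G : Graph n) (E? : Decidable (E G)) (noC3 : TriangleFree G) (noC5 : CFree 5 G) where

  data Level (u w : Fin n) : Set where
    level0  : u ≡ w → Level u w
    level1  : E G u w → Level u w
    level2  : u ≢ w → ¬ E G u w → TwoStep G u w → Level u w
    level3+ : u ≢ w → ¬ E G u w → ¬ TwoStep G u w → Level u w

  level : ∀ u w → Level u w
  level u w with u ≟ w
  ... | yes u≡w = level0 u≡w
  ... | no  u≢w with E? u w
  ...   | yes uw = level1 uw
  ...   | no ¬uw with twoStep? G E? u w
  ...     | yes t  = level2 u≢w ¬uw t
  ...     | no ¬t = level3+ u≢w ¬uw ¬t

  parity : ∀ {u w} → Level u w → Bool
  parity (level0 _)      = false
  parity (level1 _)      = true
  parity (level2 _ _ _)  = false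
  parity (level3+ _ _ _) = true

  noTwoStepsToEdge : ∀ {c w₁ w₂} → c ≢ w₁ → c ≢ w₂ → ¬ E G c w₁ → ¬ E G c w₂ →
                     TwoStep G c w₁ → TwoStep G c w₂ → E G w₁ w₂ → ⊥
  noTwoStepsToEdge c≢w₁ c≢w₂ ¬cw₁ ¬cw₂ (r₁ , cr₁ , r₁w₁) (r₂ , cr₂ , r₂w₂) w₁w₂ with r₁ ≟ r₂
  ... | yes refl = noC3 r₁w₁ w₁w₂ (E-sym G r₂w₂)
  ... | no r₁≢r₂ =
    noPentagon G noC5 c≢w₁ c≢w₂ (λ { refl → ¬cw₂ cr₁ }) r₁≢r₂ (λ { refl → ¬cw₁ cr₂ })
               cr₁ r₁w₁ w₁w₂ (E-sym G r₂w₂) (E-sym G cr₂)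

  module _ {u v} (uv : E G u v) (dominated : ∀ {w w′} → E G w w′ → Within2 G u w ⊎ Within2 G v w) where

    twoStepFrom-v : ∀ {w w′} → E G w w′ → u ≢ w → ¬ E G u w → ¬ TwoStep G u w → TwoStep G v w
    twoStepFrom-v ww′ u≢w ¬uw ¬u⇝w with dominated ww′
    ... | inj₁ (_ , inj₁ refl , inj₁ refl) = ⊥-elim (u≢w refl)
    ... | inj₁ (_ , inj₁ refl , inj₂ uw)   = ⊥-elim (¬uw uw)
    ... | inj₁ (_ , inj₂ uw   , inj₁ refl) = ⊥-elim (¬uw uw)
    ... | inj₁ (r , inj₂ ur   , inj₂ rw)   = ⊥-elim (¬u⇝w (r , ur , rw))
    ... | inj₂ (_ , inj₁ refl , inj₁ refl) = ⊥-elim (¬uw uv)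
    ... | inj₂ (_ , inj₁ refl , inj₂ vw)   = ⊥-elim (¬u⇝w (v , uv , vw))
    ... | inj₂ (_ , inj₂ vw   , inj₁ refl) = ⊥-elim (¬u⇝w (v , uv , vw))
    ... | inj₂ (r , inj₂ vr   , inj₂ rw)   = r , vr , rw

    levels-differ : ∀ {w₁ w₂} → E G w₁ w₂ → (l₁ : Level u w₁) (l₂ : Level u w₂) → parity l₁ ≢ parity l₂
    levels-differ w₁w₂ (level0 refl) (level0 refl) _ = E-irr G w₁w₂
    levels-differ w₁w₂ (level0 refl) (level2 _ ¬uw₂ _) _ = ¬uw₂ w₁w₂
    levels-differ w₁w₂ (level2 _ ¬uw₁ _) (level0 refl) _ = ¬uw₁ (E-sym G w₁w₂)
    levels-differ w₁w₂ (level1 uw₁) (level1 uw₂) _ = noC3 uw₁ w₁w₂ (E-sym G uw₂)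
    levels-differ w₁w₂ (level1 uw₁) (level3+ _ _ ¬u⇝w₂) _ = ¬u⇝w₂ (_ , uw₁ , w₁w₂)
    levels-differ w₁w₂ (level3+ _ _ ¬u⇝w₁) (level1 uw₂) _ = ¬u⇝w₁ (_ , uw₂ , E-sym G w₁w₂)
    levels-differ w₁w₂ (level2 u≢w₁ ¬uw₁ u⇝w₁) (level2 u≢w₂ ¬uw₂ u⇝w₂) _ =
      noTwoStepsToEdge u≢w₁ u≢w₂ ¬uw₁ ¬uw₂ u⇝w₁ u⇝w₂ w₁w₂
    levels-differ w₁w₂ (level3+ u≢w₁ ¬uw₁ ¬u⇝w₁) (level3+ u≢w₂ ¬uw₂ ¬u⇝w₂) _ =
      noTwoStepsToEdge (λ { refl → ¬uw₁ uv }) (λ { refl → ¬uw₂ uv })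
                       (λ vw₁ → ¬u⇝w₁ (_ , uv , vw₁)) (λ vw₂ → ¬u⇝w₂ (_ , uv , vw₂))
                       (twoStepFrom-v w₁w₂ u≢w₁ ¬uw₁ ¬u⇝w₁)
                       (twoStepFrom-v (E-sym G w₁w₂) u≢w₂ ¬uw₂ ¬u⇝w₂) w₁w₂
    levels-differ _ (level0 _)      (level1 _)      ()
    levels-differ _ (level0 _)      (level3+ _ _ _) ()
    levels-differ _ (level1 _)      (level0 _)      ()
    levels-differ _ (level1 _)      (level2 _ _ _)  ()
    levels-differ _ (level2 _ _ _)  (level1 _)      ()
    levels-differ _ (level2 _ _ _)  (level3+ _ _ _) ()
    levels-differ _ (level3+ _ _ _) (level0 _)      ()
    levels-differ _ (level3+ _ _ _) (level2 _ _ _)  ()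

    dominatingEdge⇒bipartite : Bipartite G
    dominatingEdge⇒bipartite =
      (λ w → parity (level u w)) , λ w₁ w₂ w₁w₂ → levels-differ w₁w₂ (level u w₁) (level u w₂)

module StrongCliqueProps {n : ℕ} {G : Graph n} {S : EdgeSet n} (clique : StrongClique G S) where

  S-sym : SymmetricEdgeSet S
  S-sym = proj₁ clique

  S-flip : ∀ {u v} → S u v ≡ true → S v u ≡ true
  S-flip {u} {v} uv∈S = trans (sym (S-sym u v)) uv∈S

  S⊆E : ∀ {u v} → S u v ≡ true → E G u v
  S⊆E {u} {v} = proj₁ (proj₂ clique) (u , v)

  S-dist : ∀ e f → e ∈ₛ S → f ∈ₛ S → Dist≤2 G e f
  S-dist = proj₂ (proj₂ clique)

  S-close : ∀ {u₁ u₂ w₁ w₂} → S u₁ u₂ ≡ true → S w₁ w₂ ≡ true → EdgesClose G (u₁ , u₂) (w₁ , w₂)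
  S-close e∈S f∈S = dist≤2⇒edgesClose G (S-dist _ _ e∈S f∈S)

  attach : ∀ {u v p q} → S u v ≡ true → S p q ≡ true → ¬ Close G u p → ¬ Close G u q → E G v p ⊎ E G v q
  attach uv∈S pq∈S u≁p u≁q with S-close uv∈S pq∈S
  ... | inj₁ (inj₁ up)          = ⊥-elim (u≁p up)
  ... | inj₁ (inj₂ uq)          = ⊥-elim (u≁q uq)
  ... | inj₂ (inj₁ (inj₁ refl)) = ⊥-elim (u≁p (inj₂ (S⊆E uv∈S)))
  ... | inj₂ (inj₁ (inj₂ vp))   = inj₁ vp
  ... | inj₂ (inj₂ (inj₁ refl)) = ⊥-elim (u≁q (inj₂ (S⊆E uv∈S)))
  ... | inj₂ (inj₂ (inj₂ vq))   = inj₂ vq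

module _ {n : ℕ} {G : Graph n} {S : EdgeSet n}
         (E? : Decidable (E G)) (maximum : MaximumStrongClique G S) where
  open StrongCliqueProps {G = G} {S} (proj₁ maximum)

  -- Otherwise S ∪ {xy} would be a larger strong clique.
  farEdge-exists : ∀ {x y} → E G x y → S x y ≡ false →
                   Σ (Pair n) λ f → f ∈ₛ S × ¬ EdgesClose G (x , y) f
  farEdge-exists {x} {y} xy xy∉S with anyPair? (λ f → (f ∈ₛ? S) ×-dec ¬? (edgesClose? G E? (x , y) f))
  ... | yes far  = far
  ... | no noFar = ⊥-elim (<⇒≱ larger (proj₂ maximum S′ clique′))
    where
    S′ = addEdge S x y
    close-xy : ∀ {f₁ f₂} → S f₁ f₂ ≡ true → EdgesClose G (x , y) (f₁ , f₂)
    close-xy f∈S with edgesClose? G E? _ _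
    ... | yes c  = c
    ... | no ¬c = ⊥-elim (noFar (_ , f∈S , ¬c))
    S′-close : ∀ e f → e ∈ₛ S′ → f ∈ₛ S′ → EdgesClose G e f
    S′-close _ _ e∈S′ f∈S′ with addEdge-elim {S = S} e∈S′ | addEdge-elim {S = S} f∈S′
    ... | inj₁ e∈S  | inj₁ f∈S  = S-close e∈S f∈S
    ... | inj₂ e≡xy | inj₁ f∈S  = edgesClose-respˡ G e≡xy (close-xy f∈S)
    ... | inj₁ e∈S  | inj₂ f≡xy = edgesClose-sym G (edgesClose-respˡ G f≡xy (close-xy e∈S))
    ... | inj₂ e≡xy | inj₂ f≡xy =
      edgesClose-respˡ G e≡xy (edgesClose-sym G (edgesClose-respˡ G f≡xy (edgesClose-refl G)))
    S′⊆E : ∀ e → e ∈ₛ S′ → IsEdge G e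
    S′⊆E _ e∈S′ with addEdge-elim {S = S} e∈S′
    ... | inj₁ e∈S                  = S⊆E e∈S
    ... | inj₂ (inj₁ (refl , refl)) = xy
    ... | inj₂ (inj₂ (refl , refl)) = E-sym G xy
    clique′ : StrongClique G S′
    clique′ = addEdge-sym S-sym , S′⊆E , λ e f e∈S′ f∈S′ → edgesClose⇒dist≤2 G (S′-close e f e∈S′ f∈S′)
    larger : edgeCount S < edgeCount S′
    larger = edgeCount-< S-sym (addEdge-sym S-sym) addEdge-⊇ (edge⇒≢ G xy) xy∉S
                         (addEdge-new {S = S} {x} {y})

module MinimalStrongClique {n : ℕ} {G : Graph n} {S : EdgeSet n}
                           (clique : StrongClique G S) (minimal : Minimal G S) where
  open StrongCliqueProps {G = G} {S} clique
  open Decidable⇒UIP _≟ᵇ_ using (≡-irrelevant)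

  middle : ∀ {e f} → Dist≤2 G e f → Maybe (Pair n)
  middle (inj₂ (inj₂ (g , _))) = just g
  middle _                     = nothing

  middle-edge : ∀ {e f g} (d : Dist≤2 G e f) → middle d ≡ just g → IsEdge G g
  middle-edge (inj₂ (inj₂ (_ , g-edge , _))) refl = g-edge

  -- The proof that S is a strong clique fixes one witness path for each pair of S-edges;
  -- an edge of G is Used if it lies in S or is the middle edge of one of these paths.
  chosenMiddle : Pair n → Pair n → Maybe (Pair n)
  chosenMiddle e f with e ∈ₛ? S | f ∈ₛ? S
  ... | yes e∈S | yes f∈S = middle (S-dist e f e∈S f∈S)
  ... | _       | _       = nothing

  chosenMiddle-spec : ∀ e f (e∈S : e ∈ₛ S) (f∈S : f ∈ₛ S) → chosenMiddle e f ≡ middle (S-dist e f e∈S f∈S)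
  chosenMiddle-spec e f e∈S f∈S with e ∈ₛ? S | f ∈ₛ? S
  ... | yes p  | yes q  = cong₂ (λ p q → middle (S-dist e f p q)) (≡-irrelevant p e∈S) (≡-irrelevant q f∈S)
  ... | no ¬p | _      = ⊥-elim (¬p e∈S)
  ... | yes _  | no ¬q = ⊥-elim (¬q f∈S)

  chosenMiddle-edge : ∀ e f {g} → chosenMiddle e f ≡ just g → IsEdge G g
  chosenMiddle-edge e f with e ∈ₛ? S | f ∈ₛ? S
  ... | yes e∈S | yes f∈S = middle-edge (S-dist e f e∈S f∈S)
  ... | yes _   | no _    = λ ()
  ... | no _    | _       = λ ()

  OnChosenPath : Fin n → Fin n → Set
  OnChosenPath x y = Σ (Pair n) λ e → Σ (Pair n) λ f → chosenMiddle e f ≡ just (x , y)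

  Used : Fin n → Fin n → Set
  Used x y = S x y ≡ true ⊎ OnChosenPath x y ⊎ OnChosenPath y x

  used-sym : ∀ {x y} → Used x y → Used y x
  used-sym (inj₁ xy∈S)        = inj₁ (S-flip xy∈S)
  used-sym (inj₂ (inj₁ path)) = inj₂ (inj₂ path)
  used-sym (inj₂ (inj₂ path)) = inj₂ (inj₁ path)

  used? : Decidable Used
  used? x y = (S x y ≟ᵇ true) ⊎-dec (onChosenPath? x y ⊎-dec onChosenPath? y x)
    where
    onChosenPath? : Decidable OnChosenPath
    onChosenPath? x y = anyPair? λ e → anyPair? λ f →
      Maybe.≡-dec (Product.≡-dec _≟_ _≟_) (chosenMiddle e f) (just (x , y))

  used⇒edge : ∀ {x y} → Used x y → E G x y
  used⇒edge (inj₁ xy∈S)                = S⊆E xy∈S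
  used⇒edge (inj₂ (inj₁ (e , f , eq))) = chosenMiddle-edge e f eq
  used⇒edge (inj₂ (inj₂ (e , f , eq))) = E-sym G (chosenMiddle-edge e f eq)

  usedSubgraph : Graph n
  usedSubgraph = restrict G Used used-sym

  clique-usedSubgraph : StrongClique usedSubgraph S
  clique-usedSubgraph = S-sym , (λ _ e∈S → S⊆E e∈S , inj₁ e∈S) ,
                        λ e f e∈S f∈S → lift (S-dist e f e∈S f∈S) (chosenMiddle-spec e f e∈S f∈S)
    where
    lift : ∀ {e f} (d : Dist≤2 G e f) → chosenMiddle e f ≡ middle d → Dist≤2 usedSubgraph e f
    lift (inj₁ same)       _ = inj₁ same
    lift (inj₂ (inj₁ adj)) _ = inj₂ (inj₁ adj)
    lift {e} {f} (inj₂ (inj₂ (g , g-edge , eg , gf))) eq =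
      inj₂ (inj₂ (g , (g-edge , inj₂ (inj₁ (e , f , eq))) , eg , gf))

  edge⇒used : ∀ {x y} → E G x y → Used x y
  edge⇒used {x} {y} xy with used? x y
  ... | yes used = used
  ... | no ¬used = ⊥-elim (minimal usedSubgraph proper clique-usedSubgraph)
    where proper = restrict-proper {G = G} {P = Used} {P-sym = used-sym} xy ¬used

  -- E G is not decidable a priori; minimality identifies it with the decidable relation Used.
  E? : Decidable (E G)
  E? x y = map′ used⇒edge edge⇒used (used? x y)

  record Joins (x y : Fin n) : Set where
    field
      a b  : Fin n
      xa∈S : S x a ≡ true
      yb∈S : S y b ≡ true
      x≁b  : ¬ Close G x b
      a≁y  : ¬ Close G a y
      a≁b  : ¬ Close G a b

  joins-swap : ∀ {x y} → Joins x y → Joins y x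
  joins-swap J = record { a = b ; b = a ; xa∈S = yb∈S ; yb∈S = xa∈S
                        ; x≁b = a≁y ∘ close-sym G ; a≁y = x≁b ∘ close-sym G ; a≁b = a≁b ∘ close-sym G }
    where open Joins J

  module _ {x y : Fin n} (xy : E G x y) (xy∉S : S x y ≡ false) where

    private
      G∖xy : Graph n
      G∖xy = G ∖ (x , y)

      ¬sameEdge-S : ∀ {u v} → S u v ≡ true → ¬ SameEdge (u , v) (x , y)
      ¬sameEdge-S uv∈S (inj₁ (refl , refl)) with trans (sym uv∈S) xy∉S
      ... | ()
      ¬sameEdge-S uv∈S (inj₂ (refl , refl)) with trans (sym (S-flip uv∈S)) xy∉S
      ... | ()

      restore : ∀ {u w} → ¬ SameEdge (u , w) (x , y) → ¬ Close G∖xy u w → ¬ Close G u w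
      restore _     u≁w (inj₁ u≡w) = u≁w (inj₁ u≡w)
      restore ¬same u≁w (inj₂ uw)  = u≁w (inj₂ (uw , ¬same))

      closeOnlyVia-xy : ∀ {u w} → Close G u w → ¬ Close G∖xy u w → SameEdge (u , w) (x , y)
      closeOnlyVia-xy (inj₁ u≡w) u≁w = ⊥-elim (u≁w (inj₁ u≡w))
      closeOnlyVia-xy {u} {w} (inj₂ uw) u≁w with sameEdge? (u , w) (x , y)
      ... | yes same  = same
      ... | no ¬same = ⊥-elim (u≁w (inj₂ (uw , ¬same)))

      joins-from : ∀ {a b} → S x a ≡ true → S y b ≡ true →
                   ¬ Close G∖xy x b → ¬ Close G∖xy a y → ¬ Close G∖xy a b → Joins x y
      joins-from {a} {b} xa∈S yb∈S x≁b a≁y a≁b = record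
        { a = a ; b = b ; xa∈S = xa∈S ; yb∈S = yb∈S
        ; x≁b = restore (λ { (inj₁ (_ , refl)) → edge⇒≢ G (S⊆E yb∈S) refl
                           ; (inj₂ (x≡y , _)) → edge⇒≢ G xy x≡y }) x≁b
        ; a≁y = restore (λ { (inj₁ (refl , _)) → edge⇒≢ G (S⊆E xa∈S) refl
                           ; (inj₂ (_ , y≡x)) → edge⇒≢ G xy (sym y≡x) }) a≁y
        ; a≁b = restore (λ { (inj₁ (refl , _)) → edge⇒≢ G (S⊆E xa∈S) refl
                           ; (inj₂ (a≡y , _)) → a≁y (inj₁ a≡y) }) a≁b
        }

      separated⇒joins₁₁ : ∀ {e₁ e₂ f₁ f₂} → S e₁ e₂ ≡ true → S f₁ f₂ ≡ true →
                          ¬ EdgesClose G∖xy (e₁ , e₂) (f₁ , f₂) → Close G e₁ f₁ → Joins x y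
      separated⇒joins₁₁ e∈S f∈S apart c with closeOnlyVia-xy c (apart ∘ inj₁ ∘ inj₁)
      ... | inj₁ (refl , refl) =
        joins-from e∈S f∈S (apart ∘ inj₁ ∘ inj₂) (apart ∘ inj₂ ∘ inj₁) (apart ∘ inj₂ ∘ inj₂)
      ... | inj₂ (refl , refl) =
        joins-from f∈S e∈S (apart ∘ inj₂ ∘ inj₁ ∘ close-sym G∖xy) (apart ∘ inj₁ ∘ inj₂ ∘ close-sym G∖xy)
                           (apart ∘ inj₂ ∘ inj₂ ∘ close-sym G∖xy)

      separated⇒joins : ∀ {e₁ e₂ f₁ f₂} → S e₁ e₂ ≡ true → S f₁ f₂ ≡ true →
                        ¬ EdgesClose G∖xy (e₁ , e₂) (f₁ , f₂) → Joins x y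
      separated⇒joins e∈S f∈S apart with S-close e∈S f∈S
      ... | inj₁ (inj₁ c) = separated⇒joins₁₁ e∈S f∈S apart c
      ... | inj₁ (inj₂ c) = separated⇒joins₁₁ e∈S (S-flip f∈S) (apart ∘ edgesClose-swapʳ G∖xy) c
      ... | inj₂ (inj₁ c) = separated⇒joins₁₁ (S-flip e∈S) f∈S (apart ∘ edgesClose-swapˡ G∖xy) c
      ... | inj₂ (inj₂ c) = separated⇒joins₁₁ (S-flip e∈S) (S-flip f∈S)
                              (apart ∘ edgesClose-swapˡ G∖xy ∘ edgesClose-swapʳ G∖xy) c

      E∖xy? : Decidable (E G∖xy)
      E∖xy? u v = E? u v ×-dec ¬? (sameEdge? (u , v) (x , y))

    -- S is not a strong clique of G ∖ xy, so some two S-edges are only linked through xy.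
    joins : Joins x y
    joins with anyPair? (λ e → anyPair? λ f →
                           ((e ∈ₛ? S) ×-dec (f ∈ₛ? S)) ×-dec ¬? (edgesClose? G∖xy E∖xy? e f))
    ... | yes (_ , _ , (e∈S , f∈S) , apart) = separated⇒joins e∈S f∈S apart
    ... | no none = ⊥-elim (minimal G∖xy (∖-proper G xy) clique∖xy)
      where
      close∖xy : ∀ e f → e ∈ₛ S → f ∈ₛ S → EdgesClose G∖xy e f
      close∖xy e f e∈S f∈S with edgesClose? G∖xy E∖xy? e f
      ... | yes c  = c
      ... | no ¬c = ⊥-elim (none (e , f , (e∈S , f∈S) , ¬c))
      clique∖xy : StrongClique G∖xy S
      clique∖xy = S-sym , (λ _ e∈S → S⊆E e∈S , ¬sameEdge-S e∈S) ,
                  λ e f e∈S f∈S → edgesClose⇒dist≤2 G∖xy (close∖xy e f e∈S f∈S)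

  S-edge-at : ∀ {w w′} → E G w w′ → Σ (Fin n) λ a → S w a ≡ true
  S-edge-at {w} {w′} ww′ with S w w′ in ww′∈S
  ... | true  = w′ , ww′∈S
  ... | false = Joins.a J , Joins.xa∈S J
    where J = joins ww′ ww′∈S

  S-dominated : ∀ {u v w w′} → S u v ≡ true → E G w w′ → Within2 G u w ⊎ Within2 G v w
  S-dominated uv∈S ww′ with S-edge-at ww′
  ... | a , wa∈S with S-close wa∈S uv∈S
  ...   | inj₁ (inj₁ wu) = inj₁ (_ , inj₁ refl , close-sym G wu)
  ...   | inj₁ (inj₂ wv) = inj₂ (_ , inj₁ refl , close-sym G wv)
  ...   | inj₂ (inj₁ au) = inj₁ (a , close-sym G au , inj₂ (E-sym G (S⊆E wa∈S)))
  ...   | inj₂ (inj₂ av) = inj₂ (a , close-sym G av , inj₂ (E-sym G (S⊆E wa∈S)))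

module _ {n : ℕ} {G : Graph n} {S : EdgeSet n} (noC5 : CFree 5 G)
         (maximum : MaximumStrongClique G S) (minimal : Minimal G S) where
  open StrongCliqueProps {G = G} {S} (proj₁ maximum)
  open MinimalStrongClique {G = G} {S} (proj₁ maximum) minimal

  record FarEdge (x y : Fin n) : Set where
    field
      p q  : Fin n
      pq∈S : S p q ≡ true
      x≁p  : ¬ Close G x p
      x≁q  : ¬ Close G x q
      y≁p  : ¬ Close G y p
      y≁q  : ¬ Close G y q

  farEdge : ∀ {x y} → E G x y → S x y ≡ false → FarEdge x y
  farEdge xy xy∉S with farEdge-exists {G = G} E? maximum xy xy∉S
  ... | (p , q) , pq∈S , apart = record
    { p = p ; q = q ; pq∈S = pq∈S
    ; x≁p = apart ∘ inj₁ ∘ inj₁ ; x≁q = apart ∘ inj₁ ∘ inj₂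
    ; y≁p = apart ∘ inj₂ ∘ inj₁ ; y≁q = apart ∘ inj₂ ∘ inj₂
    }

  farEdge-reverse : ∀ {x y} → FarEdge x y → FarEdge x y
  farEdge-reverse F = record { p = q ; q = p ; pq∈S = S-flip pq∈S
                             ; x≁p = x≁q ; x≁q = x≁p ; y≁p = y≁q ; y≁q = y≁p }
    where open FarEdge F

  farEdge-swap : ∀ {x y} → FarEdge x y → FarEdge y x
  farEdge-swap F = record { p = q ; q = p ; pq∈S = S-flip pq∈S
                          ; x≁p = y≁q ; x≁q = y≁p ; y≁p = x≁q ; y≁q = x≁p }
    where open FarEdge F

  ¬sharedAttachment : ∀ {x y} → E G x y → (J : Joins x y) (F : FarEdge x y) →
                      E G (Joins.a J) (FarEdge.p F) → E G (Joins.b J) (FarEdge.p F) → ⊥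
  ¬sharedAttachment xy J F ap bp =
    noPentagon G noC5 (x≁p ∘ inj₁) (x≁b ∘ inj₁) (a≁b ∘ inj₁) (a≁y ∘ inj₁) (λ { refl → y≁p (inj₁ refl) })
               (S⊆E xa∈S) ap (E-sym G bp) (E-sym G (S⊆E yb∈S)) (E-sym G xy)
    where open Joins J
          open FarEdge F

  module CrossedAttachment {x y z} (xy : E G x y) (yz : E G y z) (zx : E G z x)
                           (J : Joins x y) (F : FarEdge x y)
                           (ap : E G (Joins.a J) (FarEdge.p F)) (bq : E G (Joins.b J) (FarEdge.q F)) where
    open Joins J
    open FarEdge F

    z≢p : z ≢ p
    z≢p refl = x≁p (inj₂ (E-sym G zx))

    z≢q : z ≢ q
    z≢q refl = x≁q (inj₂ (E-sym G zx))

    z≁p : ¬ E G z p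
    z≁p zp = noPentagon G noC5 z≢q (λ { refl → x≁b (inj₂ (E-sym G zx)) })
                        (λ { refl → y≁p (inj₂ (S⊆E yb∈S)) }) (λ { refl → y≁p (inj₁ refl) }) (λ { refl → y≁q (inj₁ refl) })
                        zp (S⊆E pq∈S) (E-sym G bq) (E-sym G (S⊆E yb∈S)) yz

    z≁q : ¬ E G z q
    z≁q zq = noPentagon G noC5 z≢p (λ { refl → a≁y (inj₂ (E-sym G yz)) })
                        (λ { refl → x≁q (inj₂ (S⊆E xa∈S)) }) (λ { refl → x≁q (inj₁ refl) }) (λ { refl → x≁p (inj₁ refl) })
                        zq (E-sym G (S⊆E pq∈S)) (E-sym G ap) (E-sym G (S⊆E xa∈S)) (E-sym G zx)

    xz∉S : S x z ≡ false
    xz∉S with S x z in xz∈S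
    ... | false = refl
    ... | true  = ⊥-elim ([ z≁p , z≁q ]′ (attach xz∈S pq∈S x≁p x≁q))

    -- Joins x z gives zb′ ∈ S with x ≁ b′; b′ attaches to p or q, and every choice but b′ = b
    -- closes a pentagon.
    z~b : E G z b
    z~b = attachedTo-b zb′∈S x≁b′ (attach zb′∈S pq∈S [ z≢p , z≁p ]′ [ z≢q , z≁q ]′)
      where
      open Joins (joins (E-sym G zx) xz∉S) using () renaming (yb∈S to zb′∈S; x≁b to x≁b′)
      attachedTo-b : ∀ {b′} → S z b′ ≡ true → ¬ Close G x b′ → E G b′ p ⊎ E G b′ q → E G z b
      attachedTo-b {b′} zb′∈S x≁b′ (inj₁ b′p) with b′ ≟ a
      ... | yes refl = ⊥-elim (x≁b′ (inj₂ (S⊆E xa∈S)))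
      ... | no b′≢a  = ⊥-elim (noPentagon G noC5 z≢p (λ { refl → a≁y (inj₂ (E-sym G yz)) }) b′≢a
                                (λ { refl → x≁b′ (inj₁ refl) }) (λ { refl → x≁p (inj₁ refl) })
                                (S⊆E zb′∈S) b′p (E-sym G ap) (E-sym G (S⊆E xa∈S)) (E-sym G zx))
      attachedTo-b {b′} zb′∈S x≁b′ (inj₂ b′q) with b′ ≟ b
      ... | yes refl = S⊆E zb′∈S
      ... | no b′≢b  = ⊥-elim (noPentagon G noC5 z≢q (λ { refl → x≁b (inj₂ (E-sym G zx)) }) b′≢b
                                (λ { refl → x≁b′ (inj₂ xy) }) (λ { refl → y≁q (inj₁ refl) })
                                (S⊆E zb′∈S) b′q (E-sym G bq) (E-sym G (S⊆E yb∈S)) yz)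

  ¬crossedAttachment : ∀ {x y z} → E G x y → E G y z → E G z x → (J : Joins x y) (F : FarEdge x y) →
                       E G (Joins.a J) (FarEdge.p F) → E G (Joins.b J) (FarEdge.q F) → ⊥
  ¬crossedAttachment xy yz zx J F ap bq =
    noPentagon G noC5 (a≁b ∘ inj₁) (λ { refl → x≁q (inj₂ (S⊆E xa∈S)) }) z≢q z≢p
               (λ { refl → y≁p (inj₂ (S⊆E yb∈S)) }) (E-sym G za) zb bq (E-sym G (S⊆E pq∈S)) (E-sym G ap)
    where
    open Joins J
    open FarEdge F
    open CrossedAttachment xy yz zx J F ap bq using (z≢p; z≢q) renaming (z~b to zb)
    za = CrossedAttachment.z~b (E-sym G xy) (E-sym G zx) (E-sym G yz) (joins-swap J) (farEdge-swap F) bq ap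

  triangleSide∈S : ∀ {x y z} → E G x y → E G y z → E G z x → S x y ≡ true
  triangleSide∈S {x} {y} xy yz zx with S x y in xy∈S
  ... | true  = refl
  ... | false = ⊥-elim (impossible (attach xa∈S pq∈S x≁p x≁q) (attach yb∈S pq∈S y≁p y≁q))
    where
    J = joins xy xy∈S
    F = farEdge xy xy∈S
    open Joins J
    open FarEdge F
    impossible : E G a p ⊎ E G a q → E G b p ⊎ E G b q → ⊥
    impossible (inj₁ ap) (inj₁ bp) = ¬sharedAttachment xy J F ap bp
    impossible (inj₂ aq) (inj₂ bq) = ¬sharedAttachment xy J (farEdge-reverse F) aq bq
    impossible (inj₁ ap) (inj₂ bq) = ¬crossedAttachment xy yz zx J F ap bq
    impossible (inj₂ aq) (inj₁ bp) = ¬crossedAttachment xy yz zx J (farEdge-reverse F) aq bp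

  triangleFree : ¬ HasCycle 3 (InducedV S) (InducedE S) → TriangleFree G
  triangleFree noC3ᴴ xy yz zx =
    noC3ᴴ (triangle {E = InducedE S} (λ {_} {v} uv∈S → v , uv∈S) (λ uu∈S → E-irr G (S⊆E uu∈S))
                    (triangleSide∈S xy yz zx) (triangleSide∈S yz zx xy) (triangleSide∈S zx xy yz))

lemma3p1 : ∀ {n : ℕ} (G : Graph n) (S : EdgeSet n)
             → CFree 5 G
             → MaximumStrongClique G S
             → ¬ HasCycle 3 (InducedV S) (InducedE S)
             → Minimal G S
             → Bipartite G
lemma3p1 G S noC5 maximum noC3ᴴ minimal = bipartite (anyPair? (_∈ₛ? S))
  where
  open StrongCliqueProps {G = G} {S} (proj₁ maximum)
  open MinimalStrongClique {G = G} {S} (proj₁ maximum) minimal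
  bipartite : Dec (Σ (Pair _) (_∈ₛ S)) → Bipartite G
  bipartite (yes ((u , v) , uv∈S)) =
    dominatingEdge⇒bipartite G E? (triangleFree {G = G} noC5 maximum minimal noC3ᴴ) noC5
                             (S⊆E uv∈S) (S-dominated uv∈S)
  bipartite (no noS) = (λ _ → true) , λ w w′ ww′ _ → noS ((w , _) , proj₂ (S-edge-at {w′ = w′} ww′))
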